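{- Consider precanonical forms as words over the alphabet $\{Z,H,E\}\cup\{W_i\mid i\in\mathbb{N}\}$ (well-typed words ending with $Z$, read so that $H W_i\phi$ means $H(W_i(\phi))$), and the rewriting system acting on subwords by the rules $HW_i\Rightarrow W_{i+1}H$, $\quad HE\Rightarrow EH$, $\quad W_iW_j\Rightarrow W_jW_i$ when $i<j$. This rewriting system is normalizing.
   Context: In the free strict monoidal category generated by one object $1$ and morphisms $\mu:2\to1$, $\eta:0\to1$, $\delta:1\to2$, $\varepsilon:1\to0$, $\gamma:2\to2$, the precanonical forms are defined by: $Z=\mathrm{id}_0$; for $\phi':m\to n$ a precanonical form, $H\phi'=\eta\otimes\phi'$, $E\phi'=\varepsilon\otimes\phi'$, and (for $m\ge1$, $0\le i\le n-1$) $W_i\phi'=(\mathrm{id}_i\otimes\mu\otimes\mathrm{id}_{n-1-i})\circ(\gamma_i\otimes\mathrm{id}_{n-i})\circ(\mathrm{id}_1\otimes\phi')\circ(\delta\otimes\mathrm{id}_{m-1})$, where $\gamma_0=\mathrm{id}_1$, $\gamma_{i+1}=(\mathrm{id}_i\otimes\gamma)\circ(\gamma_i\otimes\mathrm{id}_1)$. "Normalizing" is used in the sense that every word rewrites to a unique normal form (used to define canonical forms as the normal forms). -}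

module Defs where

open import Data.Nat using (ℕ; zero; suc; _<_; s≤s)
open import Data.Product using (Σ; ∃; _×_)
open import Relation.Nullary using (¬_)
open import Relation.Binary.PropositionalEquality using (_≡_)
open import Relation.Binary.Construct.Closure.ReflexiveTransitive using (Star)

-- PF m n = words denoting morphisms m → n.
--   Z : 0 → 0
--   H φ' = η ⊗ φ'      : m → suc n    for φ' : m → n
--   E φ' = ε ⊗ φ'      : suc m → n    for φ' : m → n
--   W i φ'             : m → n        for φ' : m → n, m ≥ 1, i ≤ n - 1 (i.e. i < n)
-- A word is written outermost letter first, ending with Z, e.g. H (W i φ) = "H W_i φ".
data PF : ℕ → ℕ → Set where
  Z : PF 0 0
  H : ∀ {m n} → PF m n → PF m (suc n)
  E : ∀ {m n} → PF m n → PF (suc m) n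
  W : ∀ {m n} (i : ℕ) → i < n → PF (suc m) n → PF (suc m) n

infix 4 _⟶_
data _⟶_ : ∀ {m n} → PF m n → PF m n → Set where
  HW : ∀ {m n i} (p : i < n) (φ : PF (suc m) n) →
       H (W i p φ) ⟶ W (suc i) (s≤s p) (H φ)
  HE : ∀ {m n} (φ : PF m n) → H (E φ) ⟶ E (H φ)
  WW : ∀ {m n i j} (p : i < n) (q : j < n) (φ : PF (suc m) n) → i < j →
       W i p (W j q φ) ⟶ W j q (W i p φ)
  ctxH : ∀ {m n} {φ ψ : PF m n} → φ ⟶ ψ → H φ ⟶ H ψ
  ctxE : ∀ {m n} {φ ψ : PF m n} → φ ⟶ ψ → E φ ⟶ E ψ
  ctxW : ∀ {m n} {i} (p : i < n) {φ ψ : PF (suc m) n} → φ ⟶ ψ → W i p φ ⟶ W i p ψ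

infix 4 _⟶*_
_⟶*_ : ∀ {m n} → PF m n → PF m n → Set
_⟶*_ = Star _⟶_

NF : ∀ {m n} → PF m n → Set
NF {m} {n} φ = ¬ (Σ (PF m n) λ ψ → φ ⟶ ψ)

Normalizing : Set
Normalizing = ∀ {m n} (φ : PF m n) →
  Σ (PF m n) λ ν → (φ ⟶* ν) × NF ν ×
    (∀ (ν' : PF m n) → φ ⟶* ν' → NF ν' → ν' ≡ ν)

module Submission where

-- The rules push every H to the right of all E and W letters (raising
-- the index of each W it crosses) and sort consecutive W letters into
-- non-increasing index order.
-- Existence of a normal form is then  nf φ; uniqueness holds because any
-- irreducible ν' reachable from φ satisfies  ν' = nf ν' = nf φ.

open import Defs
open import Data.Nat using (ℕ; suc; _<_; _≤_; s≤s)
open import Data.Nat.Properties using (_<?_; <⇒≤; <⇒≱; ≤⇒≯; ≮⇒≥; <-asym; <-≤-trans)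
open import Data.Product using (_,_)
open import Data.Empty using (⊥-elim)
open import Relation.Nullary using (¬_; yes; no)
open import Relation.Binary.PropositionalEquality
  using (_≡_; refl; sym; trans; cong; module ≡-Reasoning)
open import Relation.Binary.Construct.Closure.ReflexiveTransitive
  using (ε; _◅_; _◅◅_; gmap)

ctxH* : ∀ {m n} {φ ψ : PF m n} → φ ⟶* ψ → H φ ⟶* H ψ
ctxH* = gmap H ctxH

ctxE* : ∀ {m n} {φ ψ : PF m n} → φ ⟶* ψ → E φ ⟶* E ψ
ctxE* = gmap E ctxE

ctxW* : ∀ {m n i} (p : i < n) {φ ψ : PF (suc m) n} → φ ⟶* ψ → W i p φ ⟶* W i p ψ
ctxW* {i = i} p = gmap (W i p) (ctxW p)

pushH : ∀ {m n} → PF m n → PF m (suc n)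
pushH Z         = H Z
pushH (H ψ)     = H (H ψ)
pushH (E ψ)     = E (pushH ψ)
pushH (W i p ψ) = W (suc i) (s≤s p) (pushH ψ)

insertW : ∀ {m n} (i : ℕ) → i < n → PF (suc m) n → PF (suc m) n
insertW i p (W k r ψ) with i <? k
... | yes _ = W k r (insertW i p ψ)
... | no _  = W i p (W k r ψ)
insertW i p (H ψ) = W i p (H ψ)
insertW i p (E ψ) = W i p (E ψ)

nf : ∀ {m n} → PF m n → PF m n
nf Z         = Z
nf (H φ)     = pushH (nf φ)
nf (E φ)     = E (nf φ)
nf (W i p φ) = insertW i p (nf φ)

insertW-past : ∀ {m n i k} (p : i < n) (r : k < n) (ψ : PF (suc m) n) → i < k →
               insertW i p (W k r ψ) ≡ W k r (insertW i p ψ)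
insertW-past {i = i} {k} p r ψ i<k with i <? k
... | yes _   = refl
... | no i≮k  = ⊥-elim (i≮k i<k)

insertW-stop : ∀ {m n i k} (p : i < n) (r : k < n) (ψ : PF (suc m) n) → ¬ i < k →
               insertW i p (W k r ψ) ≡ W i p (W k r ψ)
insertW-stop {i = i} {k} p r ψ i≮k with i <? k
... | yes i<k = ⊥-elim (i≮k i<k)
... | no _    = refl

pushH-reduces : ∀ {m n} (ψ : PF m n) → H ψ ⟶* pushH ψ
pushH-reduces Z         = ε
pushH-reduces (H ψ)     = ε
pushH-reduces (E ψ)     = HE ψ ◅ ctxE* (pushH-reduces ψ)
pushH-reduces (W i p ψ) = HW p ψ ◅ ctxW* (s≤s p) (pushH-reduces ψ)

insertW-reduces : ∀ {m n} i (p : i < n) (ψ : PF (suc m) n) → W i p ψ ⟶* insertW i p ψ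
insertW-reduces i p (W k r ψ) with i <? k
... | yes i<k = WW p r ψ i<k ◅ ctxW* r (insertW-reduces i p ψ)
... | no _    = ε
insertW-reduces i p (H ψ) = ε
insertW-reduces i p (E ψ) = ε

nf-reduces : ∀ {m n} (φ : PF m n) → φ ⟶* nf φ
nf-reduces Z         = ε
nf-reduces (H φ)     = ctxH* (nf-reduces φ) ◅◅ pushH-reduces (nf φ)
nf-reduces (E φ)     = ctxE* (nf-reduces φ)
nf-reduces (W i p φ) = ctxW* p (nf-reduces φ) ◅◅ insertW-reduces i p (nf φ)

-- Words that may follow an H without creating an H E or H W redex.
data AdmitsH : ∀ {m n} → PF m n → Set where
  beforeZ : AdmitsH Z
  beforeH : ∀ {m n} {ψ : PF m n} → AdmitsH (H ψ)

-- Words that may follow W_i without creating a W_i W_j redex (i < j).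
data AdmitsW (i : ℕ) : ∀ {m n} → PF m n → Set where
  beforeH : ∀ {m n} {ψ : PF m n} → AdmitsW i (H ψ)
  beforeE : ∀ {m n} {ψ : PF m n} → AdmitsW i (E ψ)
  beforeW : ∀ {m n j q} {ψ : PF (suc m) n} → j ≤ i → AdmitsW i (W j q ψ)

data Canonical : ∀ {m n} → PF m n → Set where
  cZ : Canonical Z
  cE : ∀ {m n} {ψ : PF m n} → Canonical ψ → Canonical (E ψ)
  cH : ∀ {m n} {ψ : PF m n} → Canonical ψ → AdmitsH ψ → Canonical (H ψ)
  cW : ∀ {m n i p} {ψ : PF (suc m) n} → Canonical ψ → AdmitsW i ψ → Canonical (W i p ψ)

canonical⇒irreducible : ∀ {m n} {φ ψ : PF m n} → Canonical φ → ¬ (φ ⟶ ψ)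
canonical⇒irreducible (cH _ ())            (HW p φ)
canonical⇒irreducible (cH _ ())            (HE φ)
canonical⇒irreducible (cW _ (beforeW j≤i)) (WW p q φ i<j) = <⇒≱ i<j j≤i
canonical⇒irreducible (cH c _)             (ctxH s)       = canonical⇒irreducible c s
canonical⇒irreducible (cE c)               (ctxE s)       = canonical⇒irreducible c s
canonical⇒irreducible (cW c _)             (ctxW p s)     = canonical⇒irreducible c s

irreducible-H⇒admitsH : ∀ {m n} (φ : PF m n) → NF (H φ) → AdmitsH φ
irreducible-H⇒admitsH Z         _   = beforeZ
irreducible-H⇒admitsH (H _)     _   = beforeH
irreducible-H⇒admitsH (E φ)     irr = ⊥-elim (irr (_ , HE φ))
irreducible-H⇒admitsH (W _ p φ) irr = ⊥-elim (irr (_ , HW p φ))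

irreducible-W⇒admitsW : ∀ {m n i} (p : i < n) (φ : PF (suc m) n) → NF (W i p φ) → AdmitsW i φ
irreducible-W⇒admitsW p (H _) _ = beforeH
irreducible-W⇒admitsW p (E _) _ = beforeE
irreducible-W⇒admitsW {i = i} p (W k r φ) irr with i <? k
... | yes i<k = ⊥-elim (irr (_ , WW p r φ i<k))
... | no i≮k  = beforeW (≮⇒≥ i≮k)

irreducible⇒canonical : ∀ {m n} (φ : PF m n) → NF φ → Canonical φ
irreducible⇒canonical Z _ = cZ
irreducible⇒canonical (E φ) irr =
  cE (irreducible⇒canonical φ λ { (ψ , s) → irr (E ψ , ctxE s) })
irreducible⇒canonical (H φ) irr =
  cH (irreducible⇒canonical φ λ { (ψ , s) → irr (H ψ , ctxH s) })
     (irreducible-H⇒admitsH φ irr)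
irreducible⇒canonical (W i p φ) irr =
  cW (irreducible⇒canonical φ λ { (ψ , s) → irr (W i p ψ , ctxW p s) })
     (irreducible-W⇒admitsW p φ irr)

admitsW-pushH : ∀ {m n i} {ψ : PF m n} → AdmitsW i ψ → AdmitsW (suc i) (pushH ψ)
admitsW-pushH beforeH       = beforeH
admitsW-pushH beforeE       = beforeE
admitsW-pushH (beforeW j≤i) = beforeW (s≤s j≤i)

pushH-canonical : ∀ {m n} {ψ : PF m n} → Canonical ψ → Canonical (pushH ψ)
pushH-canonical cZ       = cH cZ beforeZ
pushH-canonical (cH c a) = cH (cH c a) beforeH
pushH-canonical (cE c)   = cE (pushH-canonical c)
pushH-canonical (cW c a) = cW (pushH-canonical c) (admitsW-pushH a)

admitsW-insertW : ∀ {m n i k} (p : i < n) {ψ : PF (suc m) n} →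
                  AdmitsW k ψ → i ≤ k → AdmitsW k (insertW i p ψ)
admitsW-insertW {i = i} p (beforeW {j = j} j≤k) i≤k with i <? j
... | yes _ = beforeW j≤k
... | no _  = beforeW i≤k
admitsW-insertW p beforeH i≤k = beforeW i≤k
admitsW-insertW p beforeE i≤k = beforeW i≤k

insertW-canonical : ∀ {m n} i (p : i < n) {ψ : PF (suc m) n} →
                    Canonical ψ → Canonical (insertW i p ψ)
insertW-canonical i p (cW {i = k} c a) with i <? k
... | yes i<k = cW (insertW-canonical i p c) (admitsW-insertW p a (<⇒≤ i<k))
... | no i≮k  = cW (cW c a) (beforeW (≮⇒≥ i≮k))
insertW-canonical i p (cE c)   = cW (cE c) beforeE
insertW-canonical i p (cH c a) = cW (cH c a) beforeH

nf-canonical : ∀ {m n} (φ : PF m n) → Canonical (nf φ)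
nf-canonical Z         = cZ
nf-canonical (H φ)     = pushH-canonical (nf-canonical φ)
nf-canonical (E φ)     = cE (nf-canonical φ)
nf-canonical (W i p φ) = insertW-canonical i p (nf-canonical φ)

canonical-fixed : ∀ {m n} {φ : PF m n} → Canonical φ → nf φ ≡ φ
canonical-fixed cZ = refl
canonical-fixed (cE c) = cong E (canonical-fixed c)
canonical-fixed (cH c a) = trans (cong pushH (canonical-fixed c)) (pushH-stops a)
  where
  pushH-stops : ∀ {m n} {ψ : PF m n} → AdmitsH ψ → pushH ψ ≡ H ψ
  pushH-stops beforeZ = refl
  pushH-stops beforeH = refl
canonical-fixed (cW {i = i} {p} c a) =
  trans (cong (insertW i p) (canonical-fixed c)) (insertW-stops a)
  where
  insertW-stops : ∀ {ψ} → AdmitsW i ψ → insertW i p ψ ≡ W i p ψ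
  insertW-stops beforeH                       = refl
  insertW-stops beforeE                       = refl
  insertW-stops (beforeW {q = q} {ψ = ψ} k≤i) = insertW-stop p q ψ (≤⇒≯ k≤i)

pushH-insertW : ∀ {m n} i (p : i < n) (ψ : PF (suc m) n) →
                pushH (insertW i p ψ) ≡ insertW (suc i) (s≤s p) (pushH ψ)
pushH-insertW i p (W k r ψ) with i <? k
... | yes i<k = begin
      W (suc k) (s≤s r) (pushH (insertW i p ψ))
        ≡⟨ cong (W (suc k) (s≤s r)) (pushH-insertW i p ψ) ⟩
      W (suc k) (s≤s r) (insertW (suc i) (s≤s p) (pushH ψ))
        ≡⟨ insertW-past (s≤s p) (s≤s r) (pushH ψ) (s≤s i<k) ⟨
      insertW (suc i) (s≤s p) (W (suc k) (s≤s r) (pushH ψ)) ∎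
  where open ≡-Reasoning
... | no i≮k  = sym (insertW-stop (s≤s p) (s≤s r) (pushH ψ) λ { (s≤s i<k) → i≮k i<k })
pushH-insertW i p (H ψ) = refl
pushH-insertW i p (E ψ) = refl

insertW-comm : ∀ {m n i j} (p : i < n) (q : j < n) (ψ : PF (suc m) n) → i < j →
               insertW i p (insertW j q ψ) ≡ insertW j q (insertW i p ψ)
insertW-comm {i = i} {j} p q (W k r ψ) i<j with j <? k | i <? k
... | yes j<k | yes i<k = begin
      insertW i p (W k r (insertW j q ψ)) ≡⟨ insertW-past p r _ i<k ⟩
      W k r (insertW i p (insertW j q ψ)) ≡⟨ cong (W k r) (insertW-comm p q ψ i<j) ⟩
      W k r (insertW j q (insertW i p ψ)) ≡⟨ insertW-past q r _ j<k ⟨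
      insertW j q (W k r (insertW i p ψ)) ∎
  where open ≡-Reasoning
... | yes j<k | no i≮k  = ⊥-elim (i≮k (<-≤-trans i<j (<⇒≤ j<k)))
... | no j≮k  | yes i<k = begin
      insertW i p (W j q (W k r ψ))       ≡⟨ insertW-past p q _ i<j ⟩
      W j q (insertW i p (W k r ψ))       ≡⟨ cong (W j q) (insertW-past p r ψ i<k) ⟩
      W j q (W k r (insertW i p ψ))       ≡⟨ insertW-stop q r _ j≮k ⟨
      insertW j q (W k r (insertW i p ψ)) ∎
  where open ≡-Reasoning
... | no j≮k  | no i≮k  = begin
      insertW i p (W j q (W k r ψ))       ≡⟨ insertW-past p q _ i<j ⟩
      W j q (insertW i p (W k r ψ))       ≡⟨ cong (W j q) (insertW-stop p r ψ i≮k) ⟩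
      W j q (W i p (W k r ψ))             ≡⟨ insertW-stop q p _ (<-asym i<j) ⟨
      insertW j q (W i p (W k r ψ))       ∎
  where open ≡-Reasoning
insertW-comm p q (H ψ) i<j = trans (insertW-past p q _ i<j) (sym (insertW-stop q p _ (<-asym i<j)))
insertW-comm p q (E ψ) i<j = trans (insertW-past p q _ i<j) (sym (insertW-stop q p _ (<-asym i<j)))

nf-invariant : ∀ {m n} {φ ψ : PF m n} → φ ⟶ ψ → nf φ ≡ nf ψ
nf-invariant (HW {i = i} p φ)  = pushH-insertW i p (nf φ)
nf-invariant (HE φ)            = refl
nf-invariant (WW p q φ i<j)    = insertW-comm p q (nf φ) i<j
nf-invariant (ctxH s)          = cong pushH (nf-invariant s)
nf-invariant (ctxE s)          = cong E (nf-invariant s)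
nf-invariant (ctxW {i = i} p s) = cong (insertW i p) (nf-invariant s)

nf-invariant* : ∀ {m n} {φ ψ : PF m n} → φ ⟶* ψ → nf φ ≡ nf ψ
nf-invariant* ε        = refl
nf-invariant* (s ◅ ss) = trans (nf-invariant s) (nf-invariant* ss)

mainTheorem3 : Normalizing
mainTheorem3 φ = nf φ , nf-reduces φ , nf-irreducible , unique
  where
  nf-irreducible : NF (nf φ)
  nf-irreducible (_ , s) = canonical⇒irreducible (nf-canonical φ) s

  unique : ∀ ν' → φ ⟶* ν' → NF ν' → ν' ≡ nf φ
  unique ν' φ⟶*ν' irr = begin
    ν'    ≡⟨ canonical-fixed (irreducible⇒canonical ν' irr) ⟨
    nf ν' ≡⟨ nf-invariant* φ⟶*ν' ⟨
    nf φ  ∎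
    where open ≡-Reasoning
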